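{- For every integer $p\geq 2$, $\chi_{rlid}(H_p)=\log_2\omega(H_p)+1$.
   Context: For an integer $p\geq 2$, the graph $H_p$ has vertex set $K\cup S_1\cup S_2\cup S_3$, where $K=\{x_Q: Q\subseteq\{1,\dots,p\}\}$ (so $|K|=2^p$), $S_1=\{y_1,\dots,y_p\}$, $S_2=\{y'_1,\dots,y'_p\}$, $S_3=\{z_1,\dots,z_p\}$. Its edges are: all pairs of distinct vertices of $K$ (so $K$ is a clique); $x_{\{i\}}y_i$ and $y_iy'_i$ for every $i\in\{1,\dots,p\}$; and $x_Qz_i$ for every $Q\subseteq\{1,\dots,p\}$ with $|Q|\geq 2$ and every $i\in Q$. There are no other edges (in particular $S_1,S_2,S_3$ are stable sets). $\omega(H)$ denotes the maximum size of a clique of $H$. For a vertex $x$, $N[x]$ is its closed neighborhood. An $rlid$-coloring of a graph $H$ is a map $c:V(H)\to\mathbb{N}$ (not necessarily proper) such that for every pair of adjacent vertices $u,v$ with $N[u]\neq N[v]$ we have $c(N[u])\neq c(N[v])$, where $c(X)=\{c(x):x\in X\}$; $\chi_{rlid}(H)$ is the minimum number of colors in an $rlid$-coloring of $H$. The logarithm is base $2$. -}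

module Defs where

open import Data.Nat using (ℕ; _≤_; _^_; _*_)
open import Data.Fin using (Fin)
open import Data.Fin.Subset using (Subset; ⁅_⁆; ∣_∣; _∈_)
open import Data.Product using (Σ; ∃; _×_)
open import Data.Sum using (_⊎_)
open import Data.Empty using (⊥)
open import Relation.Nullary using (¬_)
open import Relation.Binary.PropositionalEquality using (_≡_; _≢_)
open import Function.Bundles using (_⇔_)

N[_] : {V : Set} → (V → V → Set) → V → V → Set
N[_] Adj u w = (w ≡ u) ⊎ Adj u w

SameN : {V : Set} → (V → V → Set) → V → V → Set
SameN Adj u v = ∀ w → (N[ Adj ] u w ⇔ N[ Adj ] v w)

ColoursOfN : {V C : Set} → (V → V → Set) → (V → C) → V → C → Set
ColoursOfN Adj c u col = Σ _ (λ w → N[ Adj ] u w × c w ≡ col)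

IsRlidColouring : {V : Set} → (V → V → Set) → {k : ℕ} → (V → Fin k) → Set
IsRlidColouring Adj c =
  ∀ u v → Adj u v → ¬ SameN Adj u v →
    ¬ (∀ col → (ColoursOfN Adj c u col ⇔ ColoursOfN Adj c v col))

IsChiRlid : {V : Set} → (V → V → Set) → ℕ → Set
IsChiRlid {V} Adj k =
  Σ (V → Fin k) (IsRlidColouring Adj) ×
  (∀ m → (c : V → Fin m) → IsRlidColouring Adj c → k ≤ m)

IsClique : {V : Set} → (V → V → Set) → {m : ℕ} → (Fin m → V) → Set
IsClique Adj f = ∀ i j → i ≢ j → Adj (f i) (f j)

IsCliqueNumber : {V : Set} → (V → V → Set) → ℕ → Set
IsCliqueNumber {V} Adj m =
  Σ (Fin m → V) (IsClique Adj) ×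
  (∀ n → (f : Fin n → V) → IsClique Adj f → n ≤ m)

data Vtx (p : ℕ) : Set where
  x  : Subset p → Vtx p
  y  : Fin p → Vtx p
  y' : Fin p → Vtx p
  z  : Fin p → Vtx p

AdjH : (p : ℕ) → Vtx p → Vtx p → Set
AdjH p (x Q) (x R)  = Q ≢ R
AdjH p (x Q) (y i)  = Q ≡ ⁅ i ⁆
AdjH p (y i) (x Q)  = Q ≡ ⁅ i ⁆
AdjH p (y i) (y' j) = i ≡ j
AdjH p (y' j) (y i) = i ≡ j
AdjH p (x Q) (z i)  = (2 ≤ ∣ Q ∣) × (i ∈ Q)
AdjH p (z i) (x Q)  = (2 ≤ ∣ Q ∣) × (i ∈ Q)
AdjH p _ _          = ⊥

module Submission where

-- The 2^p vertices of the clique K are pairwise adjacent and have pairwise distinct closed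
-- neighbourhoods, so an rlid-colouring with m colours gives them 2^p distinct non-empty colour
-- sets: 2^p < 2^m, i.e. m ≥ p + 1. Conversely, colour K with 0, y_i and z_i with i, and y'_i with
-- some j ≠ i (this needs p ≥ 2): the colour set of N[x_Q] then determines Q, and every other edge
-- is separated by 0 or by such a j. Finally ω(H_p) = 2^p, because K is a clique and labelling
-- x_Q by Q, y_i and z_i by ∅, and y'_i by {i} properly colours H_p with 2^p colours.

open import Defs
open import Data.Nat using (ℕ; _≤_; _^_; _*_)
open import Data.Product using (Σ; _×_)
open import Relation.Binary.PropositionalEquality using (_≡_)

open import Level using (Level)
import Data.Nat as ℕ
open import Data.Nat using (_+_; s≤s; z≤n; _<_; _<?_)
open import Data.Nat.Properties using (≤-trans; ≤-<-trans; ^-monoʳ-≤; ≮⇒≥; <⇒≱)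
open import Data.Empty using (⊥-elim)
open import Data.Fin using (Fin; zero; suc; _≟_; combine; funToFin; finToFun; punchIn)
open import Data.Fin.Properties
  using (2↔Bool; funToFin-finToFin; finToFun-funToFin; injective⇒≤; punchInᵢ≢i; suc-injective; sequence)
open import Data.Fin.Subset using (Subset; ⁅_⁆; ∣_∣; _∈_; _∉_; ⊥; inside; outside; Nonempty)
open import Data.Fin.Subset.Properties
  using (x∈⁅x⁆; x∈⁅y⁆⇒x≡y; ∉⊥; nonempty?; Empty-unique; x∈p⇒∣p-x∣<∣p∣; drop-there)
open import Data.Vec using ([]; _∷_; here; there; lookup; tabulate)
open import Data.Vec.Properties using (lookup∘tabulate; tabulate∘lookup; tabulate-cong)
open import Data.Product using (_,_; ∃)
import Data.Product as Product
open import Data.Sum using (_⊎_; inj₁; inj₂)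
import Data.Sum as Sum
open import Effect.Monad using (RawMonad)
open import Function using (_∘_; _↔_; _⇔_; Injective; Inverse; Injection; Equivalence; mk↔ₛ′; mk⇔)
open import Function.Properties.Inverse using (↔-sym; ↔⇒↣)
open import Function.Construct.Symmetry using (⇔-sym)
open import Relation.Nullary using (¬_; Dec; does; yes; no; contradiction)
open import Relation.Nullary.Decidable using (decidable-stable; ¬¬-excluded-middle)
open import Relation.Nullary.Negation using (¬¬-Monad)
open import Relation.Binary.PropositionalEquality using (_≢_; refl; sym; trans; cong; cong₂; subst)
open import Relation.Unary using (Pred; Decidable; Satisfiable)
open import Relation.Unary.Properties using (∅?)

private
  variable
    a b ℓ : Level
    m n : ℕ

funToFin-cong : {f g : Fin m → Fin n} → (∀ i → f i ≡ g i) → funToFin f ≡ funToFin g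
funToFin-cong {ℕ.zero} _   = refl
funToFin-cong {ℕ.suc m} f≗g = cong₂ combine (f≗g zero) (funToFin-cong (f≗g ∘ suc))

Subset↔Fin2^ : Subset n ↔ Fin (2 ^ n)
Subset↔Fin2^ {n} = mk↔ₛ′ encode decode encode∘decode decode∘encode
  where
  open Inverse 2↔Bool using ()
    renaming (to to bool; from to bit; strictlyInverseˡ to bool∘bit; strictlyInverseʳ to bit∘bool)

  encode : Subset n → Fin (2 ^ n)
  encode Q = funToFin (bit ∘ lookup Q)

  decode : Fin (2 ^ n) → Subset n
  decode k = tabulate (bool ∘ finToFun k)

  encode∘decode : ∀ k → encode (decode k) ≡ k
  encode∘decode k = trans
    (funToFin-cong {n} {2} λ i → trans (cong bit (lookup∘tabulate (bool ∘ finToFun k) i)) (bit∘bool _))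
    (funToFin-finToFin {n} {2} k)

  decode∘encode : ∀ Q → decode (encode Q) ≡ Q
  decode∘encode Q = trans
    (tabulate-cong λ i → trans (cong bool (finToFun-funToFin (bit ∘ lookup Q) i)) (bool∘bit _))
    (tabulate∘lookup Q)

subset-injection⇒≤ : (f : Fin m → Subset n) → Injective _≡_ _≡_ f → m ≤ 2 ^ n
subset-injection⇒≤ f f-injective =
  injective⇒≤ (f-injective ∘ Injection.injective (↔⇒↣ Subset↔Fin2^))

∈⇒≢⊥ : {i : Fin n} {Q : Subset n} → i ∈ Q → Q ≢ ⊥
∈⇒≢⊥ {i = i} i∈Q Q≡⊥ = ∉⊥ (subst (i ∈_) Q≡⊥ i∈Q)

∈⇒∣p∣>0 : {i : Fin n} {Q : Subset n} → i ∈ Q → 0 < ∣ Q ∣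
∈⇒∣p∣>0 i∈Q = ≤-<-trans z≤n (x∈p⇒∣p-x∣<∣p∣ i∈Q)

∣p∣>0⇒nonempty : {Q : Subset n} → 0 < ∣ Q ∣ → Nonempty Q
∣p∣>0⇒nonempty {Q = inside  ∷ Q} _       = zero , here
∣p∣>0⇒nonempty {Q = outside ∷ Q} ∣Q∣>0 = Product.map suc there (∣p∣>0⇒nonempty ∣Q∣>0)

∈⇒≡⁅⁆⊎∣p∣≥2 : {i : Fin n} {Q : Subset n} → i ∈ Q → Q ≡ ⁅ i ⁆ ⊎ 2 ≤ ∣ Q ∣
∈⇒≡⁅⁆⊎∣p∣≥2 {Q = inside ∷ Q} here with nonempty? Q
... | yes (_ , j∈Q) = inj₂ (s≤s (∈⇒∣p∣>0 j∈Q))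
... | no  Q-empty   = inj₁ (cong (inside ∷_) (Empty-unique Q-empty))
∈⇒≡⁅⁆⊎∣p∣≥2 {Q = inside  ∷ Q} (there i∈Q) = inj₂ (s≤s (∈⇒∣p∣>0 i∈Q))
∈⇒≡⁅⁆⊎∣p∣≥2 {Q = outside ∷ Q} (there i∈Q) = Sum.map₁ (cong (outside ∷_)) (∈⇒≡⁅⁆⊎∣p∣≥2 i∈Q)

∣p∣≥2⇒∃≢ : {Q : Subset n} → 2 ≤ ∣ Q ∣ → ∀ i → ∃ λ j → j ∈ Q × j ≢ i
∣p∣≥2⇒∃≢ {Q = inside ∷ Q} (s≤s ∣Q∣>0) zero =
  Product.map suc (λ j∈Q → there j∈Q , λ ()) (∣p∣>0⇒nonempty ∣Q∣>0)
∣p∣≥2⇒∃≢ {Q = inside ∷ Q} _ (suc i) = zero , here , λ ()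
∣p∣≥2⇒∃≢ {Q = outside ∷ Q} ∣Q∣≥2 zero =
  Product.map suc (λ j∈Q → there j∈Q , λ ()) (∣p∣>0⇒nonempty (≤-trans (s≤s z≤n) ∣Q∣≥2))
∣p∣≥2⇒∃≢ {Q = outside ∷ Q} ∣Q∣≥2 (suc i) =
  Product.map suc (Product.map there (_∘ suc-injective)) (∣p∣≥2⇒∃≢ ∣Q∣≥2 i)

Separates : Fin n → Subset n → Subset n → Set
Separates i Q R = i ∈ Q × i ∉ R ⊎ i ∈ R × i ∉ Q

separates-∷ : ∀ {s} {i : Fin n} {Q R : Subset n} → Separates i Q R → Separates (suc i) (s ∷ Q) (s ∷ R)
separates-∷ = Sum.map (Product.map there (_∘ drop-there)) (Product.map there (_∘ drop-there))

∃-separating : {Q R : Subset n} → Q ≢ R → ∃ λ i → Separates i Q R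
∃-separating {Q = []}          {[]}          Q≢R = contradiction refl Q≢R
∃-separating {Q = inside  ∷ Q} {outside ∷ R} _   = zero , inj₁ (here , λ ())
∃-separating {Q = outside ∷ Q} {inside  ∷ R} _   = zero , inj₂ (here , λ ())
∃-separating {Q = inside  ∷ Q} {inside  ∷ R} Q≢R =
  Product.map suc separates-∷ (∃-separating (Q≢R ∘ cong (inside ∷_)))
∃-separating {Q = outside ∷ Q} {outside ∷ R} Q≢R =
  Product.map suc separates-∷ (∃-separating (Q≢R ∘ cong (outside ∷_)))

module _ {C : Set a} {A B : Pred C ℓ} where

  ⇔-refuted-at : ∀ k → A k → ¬ B k → ¬ (∀ k → A k ⇔ B k)
  ⇔-refuted-at k Ak ¬Bk A⇔B = ¬Bk (Equivalence.to (A⇔B k) Ak)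

  ¬⇔-sym : ¬ (∀ k → A k ⇔ B k) → ¬ (∀ k → B k ⇔ A k)
  ¬⇔-sym ¬A⇔B B⇔A = ¬A⇔B (⇔-sym ∘ B⇔A)

does≡⇒→ : {A : Set a} {B : Set b} (A? : Dec A) (B? : Dec B) → does A? ≡ does B? → A → B
does≡⇒→ (yes _)  (yes Bk) _  _  = Bk
does≡⇒→ (yes _)  (no _)   () _
does≡⇒→ (no ¬Ak) _        _  Ak = contradiction Ak ¬Ak

tabulate-does-injective : {A : Pred (Fin m) a} {B : Pred (Fin m) b} (A? : Decidable A) (B? : Decidable B) →
                          tabulate (does ∘ A?) ≡ tabulate (does ∘ B?) → ∀ k → A k ⇔ B k
tabulate-does-injective A? B? tabulate≡ k =
  mk⇔ (does≡⇒→ (A? k) (B? k) does≡) (does≡⇒→ (B? k) (A? k) (sym does≡))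
  where
  does≡ : does (A? k) ≡ does (B? k)
  does≡ = trans (sym (lookup∘tabulate (does ∘ A?) k))
                (trans (cong (λ v → lookup v k) tabulate≡) (lookup∘tabulate (does ∘ B?) k))

-- The empty predicate is added as an extra point, which is where the strict inequality comes from.
distinct-decidable-predicates< : {P : Fin n → Pred (Fin m) ℓ} → (∀ i → Decidable (P i)) →
                                 (∀ i → Satisfiable (P i)) → (∀ {i j} → i ≢ j → ¬ (∀ k → P i k ⇔ P j k)) →
                                 n < 2 ^ m
distinct-decidable-predicates< {n = n} {m = m} P? inhabited distinct =
  subset-injection⇒≤ characteristic characteristic-injective
  where
  characteristic : Fin (ℕ.suc n) → Subset m
  characteristic zero    = tabulate (does ∘ ∅?)
  characteristic (suc i) = tabulate (does ∘ P? i)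

  characteristic-injective : Injective _≡_ _≡_ characteristic
  characteristic-injective {zero}  {zero}  _ = refl
  characteristic-injective {zero}  {suc j} χ≡ with k , Pjk ← inhabited j =
    ⊥-elim (Equivalence.from (tabulate-does-injective ∅? (P? j) χ≡ k) Pjk)
  characteristic-injective {suc i} {zero}  χ≡ with k , Pik ← inhabited i =
    ⊥-elim (Equivalence.to (tabulate-does-injective (P? i) ∅? χ≡ k) Pik)
  characteristic-injective {suc i} {suc j} χ≡ = cong suc (decidable-stable (i ≟ j) λ i≢j →
    distinct i≢j (tabulate-does-injective (P? i) (P? j) χ≡))

-- The conclusion is decidable, so decidability of the finitely many P i k may be assumed.
distinct-predicates< : {P : Fin n → Pred (Fin m) ℓ} → (∀ i → Satisfiable (P i)) →
                       (∀ {i j} → i ≢ j → ¬ (∀ k → P i k ⇔ P j k)) → n < 2 ^ m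
distinct-predicates< {n = n} {m = m} {P = P} inhabited distinct =
  decidable-stable (n <? 2 ^ m) λ n≮2^m →
    ¬¬-decidable λ P? → n≮2^m (distinct-decidable-predicates< P? inhabited distinct)
  where
  ¬¬-decidable : ¬ ¬ (∀ i → Decidable (P i))
  ¬¬-decidable = sequence ¬¬-applicative λ i → sequence ¬¬-applicative λ k → ¬¬-excluded-middle
    where open RawMonad ¬¬-Monad using () renaming (rawApplicative to ¬¬-applicative)

module _ {V : Set} (Adj : V → V → Set) where

  clique≤colours : (c : V → Fin m) → (∀ {u v} → Adj u v → c u ≢ c v) →
                   (f : Fin n → V) → IsClique Adj f → n ≤ m
  clique≤colours c proper f clique = injective⇒≤ {f = c ∘ f} λ {i} {j} cfi≡cfj →
    decidable-stable (i ≟ j) λ i≢j → proper (clique i j i≢j) cfi≡cfj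

  rlid-clique< : {c : V → Fin m} → IsRlidColouring Adj c → (f : Fin n → V) → IsClique Adj f →
                 (∀ {i j} → i ≢ j → ¬ SameN Adj (f i) (f j)) → n < 2 ^ m
  rlid-clique< {c = c} rlid f clique separated =
    distinct-predicates< (λ i → c (f i) , f i , inj₁ refl , refl)
                         (λ i≢j → rlid _ _ (clique _ _ i≢j) (separated i≢j))

module _ {p : ℕ} where

  ∈⇒adjacent-y⊎z : {i : Fin p} {Q : Subset p} → i ∈ Q → AdjH p (x Q) (y i) ⊎ AdjH p (x Q) (z i)
  ∈⇒adjacent-y⊎z i∈Q = Sum.map₂ (_, i∈Q) (∈⇒≡⁅⁆⊎∣p∣≥2 i∈Q)

  adjacent-y⇒∈ : {i : Fin p} {Q : Subset p} → AdjH p (x Q) (y i) → i ∈ Q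
  adjacent-y⇒∈ {i} Q≡⁅i⁆ = subst (i ∈_) (sym Q≡⁅i⁆) (x∈⁅x⁆ i)

  separates-N[x] : {i : Fin p} {Q R : Subset p} → i ∈ Q → i ∉ R → ¬ SameN (AdjH p) (x Q) (x R)
  separates-N[x] {i} i∈Q i∉R with ∈⇒adjacent-y⊎z i∈Q
  ... | inj₁ Q-y = ⇔-refuted-at (y i) (inj₂ Q-y) λ { (inj₁ ()) ; (inj₂ R-y) → i∉R (adjacent-y⇒∈ R-y) }
  ... | inj₂ Q-z = ⇔-refuted-at (z i) (inj₂ Q-z) λ { (inj₁ ()) ; (inj₂ (_ , i∈R)) → i∉R i∈R }

  distinct-N[x] : {Q R : Subset p} → Q ≢ R → ¬ SameN (AdjH p) (x Q) (x R)
  distinct-N[x] Q≢R with ∃-separating Q≢R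
  ... | _ , inj₁ (i∈Q , i∉R) = separates-N[x] i∈Q i∉R
  ... | _ , inj₂ (i∈R , i∉Q) = ¬⇔-sym (separates-N[x] i∈R i∉Q)

  K : Fin (2 ^ p) → Vtx p
  K = x ∘ Inverse.from Subset↔Fin2^

  K-clique : IsClique (AdjH p) K
  K-clique i j i≢j = i≢j ∘ Injection.injective (↔⇒↣ (↔-sym Subset↔Fin2^))

  subset-label : Vtx p → Subset p
  subset-label (x Q)  = Q
  subset-label (y _)  = ⊥
  subset-label (y' i) = ⁅ i ⁆
  subset-label (z _)  = ⊥

  subset-label-proper : {u v : Vtx p} → AdjH p u v → subset-label u ≢ subset-label v
  subset-label-proper {x Q}  {x R}  Q≢R        = Q≢R
  subset-label-proper {x Q}  {y i}  Q-y        = ∈⇒≢⊥ (adjacent-y⇒∈ Q-y)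
  subset-label-proper {y i}  {x Q}  Q-y        = ∈⇒≢⊥ (adjacent-y⇒∈ Q-y) ∘ sym
  subset-label-proper {y i}  {y' j} _          = ∈⇒≢⊥ (x∈⁅x⁆ j) ∘ sym
  subset-label-proper {y' j} {y i}  _          = ∈⇒≢⊥ (x∈⁅x⁆ j)
  subset-label-proper {x Q}  {z i}  (_ , i∈Q)  = ∈⇒≢⊥ i∈Q
  subset-label-proper {z i}  {x Q}  (_ , i∈Q)  = ∈⇒≢⊥ i∈Q ∘ sym

  ω-H : IsCliqueNumber (AdjH p) (2 ^ p)
  ω-H = (K , K-clique) , λ _ → clique≤colours (AdjH p) (Inverse.to Subset↔Fin2^ ∘ subset-label)
    λ adj → subset-label-proper adj ∘ Injection.injective (↔⇒↣ Subset↔Fin2^)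

  χ-H≥ : (c : Vtx p → Fin m) → IsRlidColouring (AdjH p) c → p < m
  χ-H≥ {m} c rlid with p <? m
  ... | yes p<m = p<m
  ... | no  p≮m = contradiction (^-monoʳ-≤ 2 (≮⇒≥ p≮m)) (<⇒≱ 2^p<2^m)
    where
    2^p<2^m : 2 ^ p < 2 ^ m
    2^p<2^m = rlid-clique< (AdjH p) rlid K K-clique (distinct-N[x] ∘ K-clique _ _)

module OptimalColouring (q : ℕ) where

  p : ℕ
  p = 2 + q

  other : Fin p → Fin p
  other i = punchIn i zero

  colour : Vtx p → Fin (ℕ.suc p)
  colour (x _)  = zero
  colour (y i)  = suc i
  colour (y' i) = suc (other i)
  colour (z i)  = suc i

  Colours : Vtx p → Pred (Fin (ℕ.suc p)) _
  Colours = ColoursOfN (AdjH p) colour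

  ColoursDiffer : Vtx p → Vtx p → Set
  ColoursDiffer u v = ¬ (∀ k → Colours u k ⇔ Colours v k)

  suc∈Colours-x⇒∈ : {i : Fin p} {Q : Subset p} → Colours (x Q) (suc i) → i ∈ Q
  suc∈Colours-x⇒∈ (_   , inj₁ refl      , ())
  suc∈Colours-x⇒∈ (x _ , inj₂ _         , ())
  suc∈Colours-x⇒∈ (y _ , inj₂ Q-y       , refl) = adjacent-y⇒∈ Q-y
  suc∈Colours-x⇒∈ (z _ , inj₂ (_ , i∈Q) , refl) = i∈Q

  ∈⇒suc∈Colours-x : {i : Fin p} {Q : Subset p} → i ∈ Q → Colours (x Q) (suc i)
  ∈⇒suc∈Colours-x {i} i∈Q with ∈⇒adjacent-y⊎z i∈Q
  ... | inj₁ Q-y = y i , inj₂ Q-y , refl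
  ... | inj₂ Q-z = z i , inj₂ Q-z , refl

  zero∉Colours-y' : {j : Fin p} → ¬ Colours (y' j) zero
  zero∉Colours-y' (_   , inj₁ refl , ())
  zero∉Colours-y' (y _ , inj₂ _    , ())

  suc∈Colours-z⇒≡ : {i j : Fin p} → Colours (z i) (suc j) → j ≡ i
  suc∈Colours-z⇒≡ (_   , inj₁ refl , refl) = refl
  suc∈Colours-z⇒≡ (x _ , inj₂ _    , ())

  separates⇒ColoursDiffer-x : {i : Fin p} {Q R : Subset p} → i ∈ Q → i ∉ R → ColoursDiffer (x Q) (x R)
  separates⇒ColoursDiffer-x {i} i∈Q i∉R = ⇔-refuted-at (suc i) (∈⇒suc∈Colours-x i∈Q) (i∉R ∘ suc∈Colours-x⇒∈)

  ColoursDiffer-xx : {Q R : Subset p} → AdjH p (x Q) (x R) → ColoursDiffer (x Q) (x R)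
  ColoursDiffer-xx Q≢R with ∃-separating Q≢R
  ... | _ , inj₁ (i∈Q , i∉R) = separates⇒ColoursDiffer-x i∈Q i∉R
  ... | _ , inj₂ (i∈R , i∉Q) = ¬⇔-sym (separates⇒ColoursDiffer-x i∈R i∉Q)

  ColoursDiffer-yx : {i : Fin p} {Q : Subset p} → AdjH p (y i) (x Q) → ColoursDiffer (y i) (x Q)
  ColoursDiffer-yx {i} Q≡⁅i⁆ = ⇔-refuted-at (suc (other i)) (y' i , inj₂ refl , refl) λ other∈ →
    punchInᵢ≢i i zero (x∈⁅y⁆⇒x≡y i (subst (other i ∈_) Q≡⁅i⁆ (suc∈Colours-x⇒∈ other∈)))

  ColoursDiffer-yy' : {i j : Fin p} → AdjH p (y i) (y' j) → ColoursDiffer (y i) (y' j)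
  ColoursDiffer-yy' {i} _ = ⇔-refuted-at zero (x ⁅ i ⁆ , inj₂ refl , refl) zero∉Colours-y'

  ColoursDiffer-xz : {Q : Subset p} {i : Fin p} → AdjH p (x Q) (z i) → ColoursDiffer (x Q) (z i)
  ColoursDiffer-xz {i = i} (∣Q∣≥2 , _) with j , j∈Q , j≢i ← ∣p∣≥2⇒∃≢ ∣Q∣≥2 i =
    ⇔-refuted-at (suc j) (∈⇒suc∈Colours-x j∈Q) (j≢i ∘ suc∈Colours-z⇒≡)

  -- Every edge of H_p already gets distinct colour sets.
  colour-rlid : IsRlidColouring (AdjH p) colour
  colour-rlid (x Q)  (x R)  adj _ = ColoursDiffer-xx adj
  colour-rlid (x Q)  (y i)  adj _ = ¬⇔-sym (ColoursDiffer-yx adj)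
  colour-rlid (y i)  (x Q)  adj _ = ColoursDiffer-yx adj
  colour-rlid (y i)  (y' j) adj _ = ColoursDiffer-yy' adj
  colour-rlid (y' j) (y i)  adj _ = ¬⇔-sym (ColoursDiffer-yy' adj)
  colour-rlid (x Q)  (z i)  adj _ = ColoursDiffer-xz adj
  colour-rlid (z i)  (x Q)  adj _ = ¬⇔-sym (ColoursDiffer-xz adj)

mainTheorem10 : (p : ℕ) → 2 ≤ p →
    Σ ℕ (λ χ → Σ ℕ (λ ω →
      IsChiRlid (AdjH p) χ × IsCliqueNumber (AdjH p) ω × (2 ^ χ ≡ 2 * ω)))
mainTheorem10 (ℕ.suc (ℕ.suc q)) (s≤s (s≤s _)) =
  3 + q , 2 ^ p , ((colour , colour-rlid) , λ _ → χ-H≥) , ω-H , refl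
  where open OptimalColouring q
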